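{- Let $p=(231,\{2\},\emptyset)$ and $r=(123,\emptyset,\{1\})$. Then for every $n\ge 0$, \[\mathrm{Av}_n(p,r)=\mathrm{Av}_n(123,231).\]
   Context: For $n\ge 0$, $\mathcal{S}_n$ is the set of permutations of $[n]=\{1,\dots,n\}$, written as words $\pi=\pi(1)\pi(2)\cdots\pi(n)$. Two words of distinct integers of the same length are order-isomorphic if their entries appear in the same relative order. A pattern of length 3 is a triple $(\sigma,X,Y)$ with $\sigma\in\mathcal{S}_3$ and $X,Y\subseteq\{1,2\}$. A permutation $\pi\in\mathcal{S}_n$ contains $(\sigma,X,Y)$ if there are indices $i_1<i_2<i_3$ such that $\pi(i_1)\pi(i_2)\pi(i_3)$ is order-isomorphic to $\sigma$, $i_{x+1}=i_x+1$ for every $x\in X$, and $j_{y+1}=j_y+1$ for every $y\in Y$, where $j_1<j_2<j_3$ are the three values $\pi(i_1),\pi(i_2),\pi(i_3)$ listed in increasing order; otherwise $\pi$ avoids it. A classical pattern $\sigma$ means $(\sigma,\emptyset,\emptyset)$. For patterns $P_1,\dots,P_m$, $\mathrm{Av}_n(P_1,\dots,P_m)$ is the set of $\pi\in\mathcal{S}_n$ avoiding every $P_i$. -}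

module Defs where

open import Data.Nat using (ℕ; suc)
open import Data.Fin using (Fin; zero; suc; toℕ; inject₁; _<_)
open import Data.Fin.Subset using (Subset; _∈_; ⊥; ⁅_⁆)
open import Data.Fin.Permutation using (Permutation′; permutation; _⟨$⟩ʳ_; _⟨$⟩ˡ_)
open import Data.Product using (Σ; _×_)
open import Relation.Binary.PropositionalEquality using (_≡_; refl)
open import Relation.Nullary using (¬_)
open import Function.Bundles using (_⇔_)

-- S_n : permutations of Fin n (0-indexed version of [n]);  π(i) = π ⟨$⟩ʳ i.
S : ℕ → Set
S n = Permutation′ n

-- A pattern of length 3: (σ, X, Y) with σ ∈ S_3 and X, Y ⊆ {1,2}.
-- Fin 2 element zero encodes 1, suc zero encodes 2.
record Pattern : Set where
  constructor pat
  field
    σ : S 3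
    X : Subset 2
    Y : Subset 2

Increasing : ∀ {n} → (Fin 3 → Fin n) → Set
Increasing ι = (ι zero < ι (suc zero)) × (ι (suc zero) < ι (suc (suc zero)))

OrderIso : ∀ {n} → S n → (Fin 3 → Fin n) → S 3 → Set
OrderIso π ι σ = ∀ a b → ((π ⟨$⟩ʳ ι a) < (π ⟨$⟩ʳ ι b)) ⇔ ((σ ⟨$⟩ʳ a) < (σ ⟨$⟩ʳ b))

Adjacent : ∀ {n} → Subset 2 → (Fin 3 → Fin n) → Set
Adjacent X f = ∀ (x : Fin 2) → x ∈ X → toℕ (f (suc x)) ≡ suc (toℕ (f (inject₁ x)))

-- π contains (σ,X,Y).  The values j₁<j₂<j₃ (the three values in
-- increasing order) are, given order-isomorphism with σ, j_k = π(i_{σ⁻¹(k)}).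
Contains : ∀ {n} → S n → Pattern → Set
Contains {n} π (pat σ X Y) =
  Σ (Fin 3 → Fin n) λ ι →
    Increasing ι × OrderIso π ι σ × Adjacent X ι
      × Adjacent Y (λ k → π ⟨$⟩ʳ ι (σ ⟨$⟩ˡ k))

Avoids : ∀ {n} → S n → Pattern → Set
Avoids π P = ¬ Contains π P

classical : S 3 → Pattern
classical σ = pat σ ⊥ ⊥

-- 0-indexed: 1 ↦ 0, 2 ↦ 1, 3 ↦ 2.
p123 : S 3
p123 = permutation (λ x → x) (λ x → x) (λ _ → refl) (λ _ → refl)

f231 : Fin 3 → Fin 3
f231 zero = suc zero
f231 (suc zero) = suc (suc zero)
f231 (suc (suc zero)) = zero

g231 : Fin 3 → Fin 3
g231 zero = suc (suc zero)
g231 (suc zero) = zero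
g231 (suc (suc zero)) = suc zero

p231 : S 3
p231 = permutation f231 g231 l r
  where
  l : ∀ x → f231 (g231 x) ≡ x
  l zero = refl
  l (suc zero) = refl
  l (suc (suc zero)) = refl
  r : ∀ x → g231 (f231 x) ≡ x
  r zero = refl
  r (suc zero) = refl
  r (suc (suc zero)) = refl

patP : Pattern
patP = pat p231 ⁅ suc zero ⁆ ⊥

patR : Pattern
patR = pat p123 ⊥ ⁅ zero ⁆

-- Avoiding 123 and 231 trivially implies avoiding the more restrictive p and r.
-- Conversely, given a 231 occurrence (i, j, k), the predicate π x > π i holds at j
-- and fails at k, so it switches from true to false between some m and m + 1 with
-- j ≤ m; then (i, m, m + 1) is an occurrence of p.  Given a 123 occurrence (i, j, k),
-- the value π i sits before j and π j does not, so some consecutive values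
-- v, v + 1 ≤ π j have positions π⁻¹ v < j ≤ π⁻¹ (v + 1).  If π⁻¹ (v + 1) lay beyond
-- k, it would form a 231 with j and k; hence (π⁻¹ v, π⁻¹ (v + 1), k) is an
-- occurrence of r.
module Submission where

open import Defs
open import Data.Nat using (ℕ; z≤n; s≤s)
open import Data.Nat.Properties using (<-trans; <⇒≤; ≤-<-trans; <-≤-trans; ≮⇒≥; ≤-reflexive)
import Data.Nat as Nat
open import Data.Fin using (Fin; zero; suc; toℕ; inject₁; _≤_; _<_)
open import Data.Fin.Properties using (<-cmp; <-irrefl; <-asym; _<?_; ≤∧≢⇒<)
open import Data.Fin.Subset using (⊥; ⁅_⁆)
open import Data.Fin.Subset.Properties using (∉⊥; x∈⁅y⁆⇒x≡y)
open import Data.Fin.Permutation using (_⟨$⟩ʳ_; _⟨$⟩ˡ_; inverseʳ; inverseˡ)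
open import Data.Product using (_×_; _,_; ∃₂)
open import Data.Empty using (⊥-elim)
open import Function.Base using (_∘_)
open import Function.Bundles using (_⇔_; mk⇔; Equivalence)
open import Level using (Level)
open import Relation.Binary.Definitions using (tri<; tri≈; tri>)
open import Relation.Binary.PropositionalEquality using (_≡_; refl; sym; trans; cong; subst; subst₂)
open import Relation.Nullary using (¬_; yes; no)
open import Relation.Unary using (Pred; Decidable)

private
  variable
    ℓ : Level
    n : ℕ

crossing : {P : Pred (Fin n) ℓ} → Decidable P → ∀ {a b} → a ≤ b → P a → ¬ P b →
           ∃₂ λ x y → a ≤ x × y ≤ b × toℕ y ≡ Nat.suc (toℕ x) × P x × ¬ P y
crossing {n = Nat.suc _} P? {zero} {zero} _ Pa ¬Pb = ⊥-elim (¬Pb Pa)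
crossing {n = Nat.suc Nat.zero} P? {zero} {suc ()} _ Pa ¬Pb
crossing {n = Nat.suc (Nat.suc _)} P? {zero} {suc b} _ Pa ¬Pb with P? (suc zero)
... | no ¬P1 = zero , suc zero , z≤n , s≤s z≤n , refl , Pa , ¬P1
... | yes P1 with crossing (λ x → P? (suc x)) {zero} {b} z≤n P1 ¬Pb
...   | x , y , _ , y≤b , y≡1+x , Px , ¬Py = suc x , suc y , z≤n , s≤s y≤b , cong Nat.suc y≡1+x , Px , ¬Py
crossing {n = Nat.suc _} P? {suc a} {suc b} (s≤s a≤b) Pa ¬Pb
  with crossing (λ x → P? (suc x)) a≤b Pa ¬Pb
... | x , y , a≤x , y≤b , y≡1+x , Px , ¬Py = suc x , suc y , s≤s a≤x , s≤s y≤b , cong Nat.suc y≡1+x , Px , ¬Py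

adjacent-⊥ : (f : Fin 3 → Fin n) → Adjacent ⊥ f
adjacent-⊥ f x x∈⊥ = ⊥-elim (∉⊥ x∈⊥)

adjacent-⁅⁆ : ∀ (f : Fin 3 → Fin n) x → toℕ (f (suc x)) ≡ Nat.suc (toℕ (f (inject₁ x))) →
              Adjacent ⁅ x ⁆ f
adjacent-⁅⁆ f x adj y y∈⁅x⁆ rewrite x∈⁅y⁆⇒x≡y x y∈⁅x⁆ = adj

contains⇒contains-classical : ∀ (π : S n) P → Contains π P → Contains π (classical (Pattern.σ P))
contains⇒contains-classical π (pat σ X Y) (ι , inc , oi , _ , _) =
  ι , inc , oi , adjacent-⊥ ι , adjacent-⊥ (λ q → π ⟨$⟩ʳ ι (σ ⟨$⟩ˡ q))

triple : Fin n → Fin n → Fin n → Fin 3 → Fin n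
triple i j k zero             = i
triple i j k (suc zero)       = j
triple i j k (suc (suc zero)) = k

increasing⇒monotone : ∀ {f : Fin 3 → Fin n} → Increasing f → ∀ {u v} → u < v → f u < f v
increasing⇒monotone (f0<f1 , f1<f2) {zero} {suc zero} _ = f0<f1
increasing⇒monotone (f0<f1 , f1<f2) {zero} {suc (suc zero)} _ = <-trans f0<f1 f1<f2
increasing⇒monotone (f0<f1 , f1<f2) {suc zero} {suc (suc zero)} _ = f1<f2
increasing⇒monotone _ {zero} {zero} ()
increasing⇒monotone _ {suc zero} {zero} ()
increasing⇒monotone _ {suc zero} {suc zero} (s≤s ())
increasing⇒monotone _ {suc (suc zero)} {zero} ()
increasing⇒monotone _ {suc (suc zero)} {suc zero} (s≤s ())
increasing⇒monotone _ {suc (suc zero)} {suc (suc zero)} (s≤s (s≤s ()))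

monotone-reflects : ∀ {m} {f : Fin m → Fin n} → (∀ {u v} → u < v → f u < f v) →
                    ∀ {u v} → f u < f v → u < v
monotone-reflects mono {u} {v} fu<fv with <-cmp u v
... | tri< u<v _ _  = u<v
... | tri≈ _ refl _ = ⊥-elim (<-irrefl refl fu<fv)
... | tri> _ _ v<u  = ⊥-elim (<-asym fu<fv (mono v<u))

orderIso⇔increasing : ∀ (π : S n) ι σ → OrderIso π ι σ ⇔ Increasing (λ q → π ⟨$⟩ʳ ι (σ ⟨$⟩ˡ q))
orderIso⇔increasing π ι σ = mk⇔ to from
  where
  f : Fin 3 → Fin _
  f q = π ⟨$⟩ʳ ι (σ ⟨$⟩ˡ q)

  f∘σ : ∀ a → f (σ ⟨$⟩ʳ a) ≡ π ⟨$⟩ʳ ι a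
  f∘σ a = cong (λ x → π ⟨$⟩ʳ ι x) (inverseˡ σ)

  σ∘σ⁻¹-< : ∀ {u v} → u < v → σ ⟨$⟩ʳ (σ ⟨$⟩ˡ u) < σ ⟨$⟩ʳ (σ ⟨$⟩ˡ v)
  σ∘σ⁻¹-< = subst₂ _<_ (sym (inverseʳ σ)) (sym (inverseʳ σ))

  to : OrderIso π ι σ → Increasing f
  to oi = Equivalence.from (oi _ _) (σ∘σ⁻¹-< (s≤s z≤n))
        , Equivalence.from (oi _ _) (σ∘σ⁻¹-< (s≤s (s≤s z≤n)))

  from : Increasing f → OrderIso π ι σ
  from inc a b = subst₂ (λ x y → (x < y) ⇔ (σ ⟨$⟩ʳ a < σ ⟨$⟩ʳ b)) (f∘σ a) (f∘σ b)
                        (mk⇔ (monotone-reflects mono) mono)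
    where
    mono : ∀ {u v} → u < v → f u < f v
    mono = increasing⇒monotone inc

module _ (π : S n) where

  values-injective : ∀ {x y} → π ⟨$⟩ʳ x ≡ π ⟨$⟩ʳ y → x ≡ y
  values-injective eq = trans (sym (inverseˡ π)) (trans (cong (π ⟨$⟩ˡ_) eq) (inverseˡ π))

  p-occurrence : ∀ {i j k} → i < j → toℕ k ≡ Nat.suc (toℕ j) →
                 π ⟨$⟩ʳ k < π ⟨$⟩ʳ i → π ⟨$⟩ʳ i < π ⟨$⟩ʳ j → Contains π patP
  p-occurrence {i} {j} {k} i<j k≡1+j πk<πi πi<πj =
    triple i j k , (i<j , ≤-reflexive (sym k≡1+j))
    , Equivalence.from (orderIso⇔increasing π (triple i j k) p231) (πk<πi , πi<πj)
    , adjacent-⁅⁆ (triple i j k) (suc zero) k≡1+j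
    , adjacent-⊥ (λ q → π ⟨$⟩ʳ triple i j k (p231 ⟨$⟩ˡ q))

  r-occurrence : ∀ {i j k} → i < j → j < k → toℕ (π ⟨$⟩ʳ j) ≡ Nat.suc (toℕ (π ⟨$⟩ʳ i)) →
                 π ⟨$⟩ʳ j < π ⟨$⟩ʳ k → Contains π patR
  r-occurrence {i} {j} {k} i<j j<k πj≡1+πi πj<πk =
    triple i j k , (i<j , j<k)
    , Equivalence.from (orderIso⇔increasing π (triple i j k) p123) (≤-reflexive (sym πj≡1+πi) , πj<πk)
    , adjacent-⊥ (triple i j k) , adjacent-⁅⁆ (λ q → π ⟨$⟩ʳ triple i j k (p123 ⟨$⟩ˡ q)) zero πj≡1+πi

  231-occurrence : ∀ {i j k} → i < j → j < k →
                   π ⟨$⟩ʳ k < π ⟨$⟩ʳ i → π ⟨$⟩ʳ i < π ⟨$⟩ʳ j → Contains π (classical p231)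
  231-occurrence {i} {j} {k} i<j j<k πk<πi πi<πj =
    triple i j k , (i<j , j<k)
    , Equivalence.from (orderIso⇔increasing π (triple i j k) p231) (πk<πi , πi<πj)
    , adjacent-⊥ (triple i j k) , adjacent-⊥ (λ q → π ⟨$⟩ʳ triple i j k (p231 ⟨$⟩ˡ q))

  231⇒p : ∀ {i j k} → i < j → j < k →
          π ⟨$⟩ʳ k < π ⟨$⟩ʳ i → π ⟨$⟩ʳ i < π ⟨$⟩ʳ j → Contains π patP
  231⇒p {i} i<j j<k πk<πi πi<πj =
    let x , y , j≤x , _ , y≡1+x , πi<πx , πi≮πy =
          crossing (λ x → π ⟨$⟩ʳ i <? π ⟨$⟩ʳ x) (<⇒≤ j<k) πi<πj (<-asym πk<πi)
        i<x = <-≤-trans i<j j≤x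
        i<y = <-trans i<x (≤-reflexive (sym y≡1+x))
        πy<πi = ≤∧≢⇒< (≮⇒≥ πi≮πy) (λ πy≡πi → <-irrefl (sym (values-injective πy≡πi)) i<y)
    in p-occurrence i<x y≡1+x πy<πi πi<πx

  contains-231⇒contains-p : Contains π (classical p231) → Contains π patP
  contains-231⇒contains-p (ι , (i<j , j<k) , oi , _) =
    let πk<πi , πi<πj = Equivalence.to (orderIso⇔increasing π ι p231) oi
    in 231⇒p i<j j<k πk<πi πi<πj

  123⇒r : Avoids π (classical p231) → ∀ {i j k} → i < j → j < k →
          π ⟨$⟩ʳ i < π ⟨$⟩ʳ j → π ⟨$⟩ʳ j < π ⟨$⟩ʳ k → Contains π patR
  123⇒r av231 {i} {j} {k} i<j j<k πi<πj πj<πk =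
    let v , w , _ , w≤πj , w≡1+v , π⁻¹v<j , j≮π⁻¹w =
          crossing (λ v → π ⟨$⟩ˡ v <? j) (<⇒≤ πi<πj)
                   (subst (_< j) (sym (inverseˡ π)) i<j)
                   (λ j<j → <-irrefl (inverseˡ π) j<j)
        ππ⁻¹v≡v = inverseʳ π {v}
        ππ⁻¹w≡w = inverseʳ π {w}
    in r-occurrence (<-≤-trans π⁻¹v<j (≮⇒≥ j≮π⁻¹w))
                    (before-k (subst (_≤ π ⟨$⟩ʳ j) (sym ππ⁻¹w≡w) w≤πj))
                    (subst₂ (λ x y → toℕ x ≡ Nat.suc (toℕ y)) (sym ππ⁻¹w≡w) (sym ππ⁻¹v≡v) w≡1+v)
                    (subst (_< π ⟨$⟩ʳ k) (sym ππ⁻¹w≡w) (≤-<-trans w≤πj πj<πk))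
    where
    before-k : ∀ {t} → π ⟨$⟩ʳ t ≤ π ⟨$⟩ʳ j → t < k
    before-k {t} πt≤πj with <-cmp t k
    ... | tri< t<k _ _  = t<k
    ... | tri≈ _ refl _ = ⊥-elim (<-irrefl refl (<-≤-trans πj<πk πt≤πj))
    ... | tri> _ _ k<t  = ⊥-elim (av231 (231-occurrence j<k k<t πt<πj πj<πk))
      where
      πt<πj = ≤∧≢⇒< πt≤πj (λ πt≡πj → <-irrefl (sym (values-injective πt≡πj)) (<-trans j<k k<t))

  contains-123⇒contains-r : Avoids π (classical p231) → Contains π (classical p123) → Contains π patR
  contains-123⇒contains-r av231 (ι , (i<j , j<k) , oi , _) =
    let πi<πj , πj<πk = Equivalence.to (orderIso⇔increasing π ι p123) oi
    in 123⇒r av231 i<j j<k πi<πj πj<πk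

proposition10 : ∀ (n : ℕ) (π : S n) →
    (Avoids π patP × Avoids π patR) ⇔ (Avoids π (classical p123) × Avoids π (classical p231))
proposition10 n π = mk⇔ to from
  where
  to : Avoids π patP × Avoids π patR → Avoids π (classical p123) × Avoids π (classical p231)
  to (avP , avR) = avR ∘ contains-123⇒contains-r π av231 , av231
    where
    av231 : Avoids π (classical p231)
    av231 = avP ∘ contains-231⇒contains-p π

  from : Avoids π (classical p123) × Avoids π (classical p231) → Avoids π patP × Avoids π patR
  from (av123 , av231) = av231 ∘ contains⇒contains-classical π patP , av123 ∘ contains⇒contains-classical π patR
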